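{- For a mixed graph $F$, $\theta(F)=\infty$ if and only if $F\subseteq K_{\overrightarrow{t,t}}$ for some positive integer $t$. Otherwise $\theta(F)\le 2$.
   Context: Mixed graphs: finite vertex set, at most one edge on each pair of distinct vertices, each edge undirected or directed (tail $\to$ head). $\alpha(G),\beta(G)$ are the numbers of undirected and directed edges divided by $\binom{v(G)}2$. $F\subseteq G$ means there is an injection $\phi:V(F)\to V(G)$ sending undirected edges of $F$ to pairs joined by an edge of either type and each directed edge $u\to v$ of $F$ to the directed edge $\phi(u)\to\phi(v)$ of $G$. $\theta(F)$ is the maximum $\rho$ with $\limsup_n\max\{\alpha(G)+\rho\beta(G):G\ F\text{ -free},\ v(G)=n\}\le1$; $\theta(F)=\infty$ if $\max\beta(G)\to0$ over $F$-free $n$-vertex $G$. $K_{\overrightarrow{a,b}}$ is the mixed graph on $A\sqcup B$, $|A|=a$, $|B|=b$, whose edges are all $ab$ pairs between $A$ and $B$, each directed from its endpoint in $A$ to its endpoint in $B$.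
   Formalization: The parameter ρ in $\theta(F)\le 2$ and the error tolerances in the limits defining $\theta(F)$ range over the rationals. -}

module Defs where

open import Data.Nat using (ℕ; zero; suc; _+_; _<ᵇ_)
open import Data.Bool using (Bool; true; false; if_then_else_; _∧_)
open import Data.Fin using (Fin; toℕ)
open import Data.List using (List; map; allFin)
open import Data.Nat.ListAction using (sum)
open import Data.Integer using (+_)
open import Data.Rational using (ℚ; _/_; 0ℚ; 1ℚ) renaming (_+_ to _+ℚ_; _*_ to _*ℚ_; _≤_ to _≤ℚ_; _<_ to _<ℚ_)
open import Data.Product using (Σ; ∃; _×_)
open import Function.Definitions using (Injective)
open import Relation.Binary.PropositionalEquality using (_≡_; _≢_; refl)
open import Relation.Nullary using (¬_)

-- The relation between an ordered pair (i , j) of distinct vertices: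
-- no edge, undirected edge, directed edge i → j (fwd), directed edge j → i (bwd).
data Kind : Set where
  none und fwd bwd : Kind

flip : Kind → Kind
flip none = none
flip und  = und
flip fwd  = bwd
flip bwd  = fwd

record MixedGraph (n : ℕ) : Set where
  field
    kind  : Fin n → Fin n → Kind
    loopless : ∀ i → kind i i ≡ none
    symm  : ∀ i j → kind j i ≡ flip (kind i j)
open MixedGraph public

_⊆_ : ∀ {k n} → MixedGraph k → MixedGraph n → Set
_⊆_ {k} {n} F G = Σ (Fin k → Fin n) λ φ → Injective _≡_ _≡_ φ ×
  (∀ i j → kind F i j ≡ und → kind G (φ i) (φ j) ≢ none) ×
  (∀ i j → kind F i j ≡ fwd → kind G (φ i) (φ j) ≡ fwd)

pairs : ℕ → ℕ
pairs zero = zero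
pairs (suc n) = n + pairs n

isUnd : Kind → Bool
isUnd und = true
isUnd _   = false

isDir : Kind → Bool
isDir fwd = true
isDir bwd = true
isDir _   = false

countPairs : ∀ {n} → MixedGraph n → (Kind → Bool) → ℕ
countPairs {n} G p = sum (map (λ i → sum (map (λ j →
  if (toℕ i <ᵇ toℕ j) ∧ p (kind G i j) then 1 else 0) (allFin n))) (allFin n))

-- edge densities (convention: 0 when n < 2, irrelevant for the limits)
density : ℕ → ℕ → ℚ
density zero m = 0ℚ
density (suc zero) m = 0ℚ
density (suc (suc k)) m = + m / pairs (suc (suc k))

α β : ∀ {n} → MixedGraph n → ℚ
α {n} G = density n (countPairs G isUnd)
β {n} G = density n (countPairs G isDir)

Free : ∀ {k n} → MixedGraph k → MixedGraph n → Set
Free F G = ¬ (F ⊆ G)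

-- max { β(G) : G F-free, v(G) = n } → 0   (i.e. θ(F) = ∞)
ThetaInfinite : ∀ {k} → MixedGraph k → Set
ThetaInfinite F = ∀ (ε : ℚ) → 0ℚ <ℚ ε → ∃ λ N → ∀ n → N Data.Nat.≤ n →
  (G : MixedGraph n) → Free F G → β G ≤ℚ ε

-- limsup_n max { α(G) + ρ β(G) : G F-free, v(G) = n } ≤ 1
LimsupLe1 : ∀ {k} → MixedGraph k → ℚ → Set
LimsupLe1 F ρ = ∀ (ε : ℚ) → 0ℚ <ℚ ε → ∃ λ N → ∀ n → N Data.Nat.≤ n →
  (G : MixedGraph n) → Free F G → (α G +ℚ (ρ *ℚ β G)) ≤ℚ (1ℚ +ℚ ε)

-- θ(F) ≤ 2 : no ρ > 2 satisfies the limsup condition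
-- (rational ρ suffices, since the condition is monotone in ρ because β ≥ 0)
ThetaLe2 : ∀ {k} → MixedGraph k → Set
ThetaLe2 F = ∀ (ρ : ℚ) → (+ 2 / 1) <ℚ ρ → ¬ LimsupLe1 F ρ

-- K_{a,b}: vertices Fin (a + b), A = those with index < a, B = the rest
kindK : Bool → Bool → Kind
kindK true  false = fwd
kindK false true  = bwd
kindK _     _     = none

kindK-loop : ∀ x → kindK x x ≡ none
kindK-loop true = refl
kindK-loop false = refl

kindK-symm : ∀ x y → kindK y x ≡ flip (kindK x y)
kindK-symm true true = refl
kindK-symm true false = refl
kindK-symm false true = refl
kindK-symm false false = refl

K⃗ : (a b : ℕ) → MixedGraph (a + b)
K⃗ a b = record
  { kind = λ i j → kindK (toℕ i <ᵇ a) (toℕ j <ᵇ a)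
  ; loopless = λ i → kindK-loop (toℕ i <ᵇ a)
  ; symm = λ i j → kindK-symm (toℕ i <ᵇ a) (toℕ j <ᵇ a)
  }

-- If F ⊆ K⃗ t t, F-free graphs have o(n²) directed edges by the Kővári–Sós–Turán
-- argument, run greedily: among the arcs from X into Y, pick the vertex x ∈ X
-- maximising the number of arcs from X into Y ∩ N⁺(x). By Cauchy–Schwarz,
-- ∑_{x ∈ X} e(X, Y ∩ N⁺(x)) = ∑_{y ∈ Y} d⁻(y)² ≥ e(X,Y)²/n, so x gets at least
-- e(X,Y)²/n². Deleting x from X loses at most n arcs, so for n ≥ 2m² the bound
-- e(X,Y) ≥ n²/m becomes e(X − x, Y ∩ N⁺(x)) ≥ n²/(2m²). After t steps (m ↦ 2m²
-- each time) the t chosen vertices have at least t common out-neighbours.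
-- Conversely, F ⊆ K⃗ t t for some t exactly when F has a 2-colouring in which
-- undirected edges cross and directed edges go from the first class to the
-- second; this is decidable, which produces the witness t. Without such a
-- colouring every K⃗ M M is F-free and has β > ½ and α ≥ 0, which refutes
-- θ(F) = ∞ and gives α + ρβ > ρ/2 > 1 for every ρ > 2.

module Submission where

open import Defs
open import Data.Bool using (Bool; true; false; if_then_else_; _∧_; not; T)
open import Data.Bool.Properties using (∧-conicalʳ; ∧-conicalˡ; not-injective)
open import Data.Fin using (Fin; zero; suc; toℕ; splitAt; _↑ˡ_; _↑ʳ_)
open import Data.Fin.Properties as Fin using (↑ˡ-injective; ↑ʳ-injective; splitAt-↑ˡ; splitAt-↑ʳ; splitAt⁻¹-↑ˡ; splitAt⁻¹-↑ʳ; all?)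
open import Data.Fin.Subset.Properties using (anySubset?)
open import Data.Vec using (lookup; tabulate)
open import Data.Vec.Properties using (lookup∘tabulate)
open import Data.List using (map; allFin) renaming (tabulate to tabulateList)
open import Data.List.Properties using (map-tabulate; map-cong)
open import Data.Nat using (ℕ; zero; suc; _+_; _*_; _≤_; _<_; _≥_; _⊔_; z≤n; s≤s; _<ᵇ_; _≡ᵇ_; _≤?_; >-nonZero)
open import Data.Nat.ListAction using () renaming (sum to sumList)
open import Data.Nat.Properties
open import Data.Nat.Tactic.RingSolver using (solve-∀)
open import Data.Sum using (inj₁; inj₂; [_,_]′)
open import Data.Product using (_,_; proj₁; proj₂; ∃; ∃₂; _×_; Σ)
open import Data.Integer as ℤ using (-[1+_])
import Data.Integer.Properties as ℤ
open import Data.Rational as ℚ using (mkℚ; _/_; 0ℚ; 1ℚ; ½; toℚᵘ)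
import Data.Rational.Properties as ℚ
open import Data.Rational.Unnormalised as ℚᵘ using (mkℚᵘ)
import Data.Rational.Unnormalised.Properties as ℚᵘ
open import Algebra.Properties.AbelianGroup ℚ.+-0-abelianGroup using (xyx⁻¹≈y)
open import Function.Bundles using (_⇔_; mk⇔)
open import Data.Empty using (⊥-elim)
open import Function using (_∘_; id)
open import Relation.Binary.PropositionalEquality
open import Relation.Binary.Definitions using (tri<; tri≈; tri>)
open import Relation.Nullary using (Dec; yes; no; ¬_; contradiction)
open import Function.Definitions using (Injective)

open import Algebra.Properties.Semiring.Sum +-*-semiring
  using (sum; sum-syntax; ∑-distrib-+; ∑-comm; sum-cong-≗; *-distribˡ-sum; *-distribʳ-sum)

𝟙 : Bool → ℕ
𝟙 b = if b then 1 else 0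

𝟙≤1 : ∀ b → 𝟙 b ≤ 1
𝟙≤1 true  = ≤-refl
𝟙≤1 false = z≤n

𝟙-∧ : ∀ a b → 𝟙 (a ∧ b) ≡ 𝟙 a * 𝟙 b
𝟙-∧ true  b = sym (+-identityʳ (𝟙 b))
𝟙-∧ false b = refl

sumList-tabulate : ∀ {n} (f : Fin n → ℕ) → sumList (tabulateList f) ≡ sum f
sumList-tabulate {zero}  f = refl
sumList-tabulate {suc n} f = cong (f zero +_) (sumList-tabulate (f ∘ suc))

sumList-allFin : ∀ {n} (f : Fin n → ℕ) → sumList (map f (allFin n)) ≡ sum f
sumList-allFin f = trans (cong sumList (map-tabulate id f)) (sumList-tabulate f)

∑-mono-≤ : ∀ {n} {f g : Fin n → ℕ} → (∀ i → f i ≤ g i) → sum f ≤ sum g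
∑-mono-≤ {zero}  f≤g = z≤n
∑-mono-≤ {suc n} f≤g = +-mono-≤ (f≤g zero) (∑-mono-≤ (f≤g ∘ suc))

∑-const : ∀ n c → ∑[ i < n ] c ≡ n * c
∑-const zero    c = refl
∑-const (suc n) c = cong (c +_) (∑-const n c)

∑-bounded : ∀ {n} {f : Fin n → ℕ} {c} → (∀ i → f i ≤ c) → sum f ≤ n * c
∑-bounded {n} {c = c} f≤c = ≤-trans (∑-mono-≤ f≤c) (≤-reflexive (∑-const n c))

∣_∣ : ∀ {n} → (Fin n → Bool) → ℕ
∣ X ∣ = ∑[ i < _ ] 𝟙 (X i)

∣X∣≤n : ∀ {n} (X : Fin n → Bool) → ∣ X ∣ ≤ n
∣X∣≤n {n} X = ≤-trans (∑-bounded (𝟙≤1 ∘ X)) (≤-reflexive (*-identityʳ n))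

∑∑-distrib-+ : ∀ {m n} (f g : Fin m → Fin n → ℕ) →
  ∑[ i < m ] ∑[ j < n ] (f i j + g i j) ≡ (∑[ i < m ] ∑[ j < n ] f i j) + (∑[ i < m ] ∑[ j < n ] g i j)
∑∑-distrib-+ f g = trans (sum-cong-≗ (λ i → ∑-distrib-+ (f i) (g i)))
                         (∑-distrib-+ (λ i → ∑[ j < _ ] f i j) (λ i → ∑[ j < _ ] g i j))

∑*∑ : ∀ {m n} (f : Fin m → ℕ) (g : Fin n → ℕ) → sum f * sum g ≡ ∑[ i < m ] ∑[ j < n ] (f i * g j)
∑*∑ f g = trans (*-distribʳ-sum (sum g) f) (sum-cong-≗ (λ i → *-distribˡ-sum (f i) g))

∑-indicator : ∀ {n} (x : Fin n) → ∑[ i < n ] 𝟙 (toℕ i ≡ᵇ toℕ x) ≡ 1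
∑-indicator {suc n} zero    = cong suc (trans (∑-const n 0) (*-zeroʳ n))
∑-indicator {suc n} (suc x) = ∑-indicator x

∑-splitAt : ∀ m n (f : Fin (m + n) → ℕ) → sum f ≡ ∑[ i < m ] f (i ↑ˡ n) + ∑[ j < n ] f (m ↑ʳ j)
∑-splitAt zero    n f = refl
∑-splitAt (suc m) n f = trans (cong (f zero +_) (∑-splitAt m n (f ∘ suc))) (sym (+-assoc (f zero) _ _))

am-gm-≤ : ∀ {u v} → u ≤ v → 2 * (u * v) ≤ u * u + v * v
am-gm-≤ {u} u≤v with m≤n⇒∃[o]m+o≡n u≤v
... | k , refl = ≤-trans (m≤m+n _ (k * k)) (≤-reflexive (square-gap u k))
  where square-gap : ∀ u k → 2 * (u * (u + k)) + k * k ≡ u * u + (u + k) * (u + k)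
        square-gap = solve-∀

am-gm : ∀ u v → 2 * (u * v) ≤ u * u + v * v
am-gm u v with ≤-total u v
... | inj₁ u≤v = am-gm-≤ u≤v
... | inj₂ v≤u = subst₂ _≤_ (cong (2 *_) (*-comm v u)) (+-comm (v * v) (u * u)) (am-gm-≤ v≤u)

double-cancel-≤ : ∀ {x y} → x + x ≤ y + y → x ≤ y
double-cancel-≤ {x} {y} x+x≤y+y with x ≤? y
... | yes x≤y = x≤y
... | no x≰y = contradiction x+x≤y+y (<⇒≱ (+-mono-< y<x y<x))
  where y<x = ≰⇒> x≰y

double-cancel-≡ : ∀ {x y} → x + x ≡ y + y → x ≡ y
double-cancel-≡ eq = ≤-antisym (double-cancel-≤ (≤-reflexive eq)) (double-cancel-≤ (≤-reflexive (sym eq)))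

cauchy-schwarz : ∀ {n} (w d : Fin n → ℕ) →
  (∑[ y < n ] (w y * d y)) * (∑[ y < n ] (w y * d y)) ≤ sum w * ∑[ y < n ] (w y * (d y * d y))
-- The sum over y, z of w_y w_z (d_y − d_z)² ≥ 0, with the negative terms moved across.
cauchy-schwarz {n} w d = double-cancel-≤ (begin
  e * e + e * e                                      ≡⟨ cong₂ _+_ (∑*∑ a a) (∑*∑ a a) ⟩
  ∑∑ (λ y z → a y * a z) + ∑∑ (λ y z → a y * a z)      ≡⟨ ∑∑-distrib-+ {n} {n} _ _ ⟨
  ∑∑ (λ y z → a y * a z + a y * a z)                  ≤⟨ ∑-mono-≤ (λ y → ∑-mono-≤ (pointwise y)) ⟩
  ∑∑ (λ y z → w y * b z + b y * w z)                  ≡⟨ ∑∑-distrib-+ {n} {n} _ _ ⟩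
  ∑∑ (λ y z → w y * b z) + ∑∑ (λ y z → b y * w z)      ≡⟨ cong₂ _+_ (∑*∑ w b) (∑*∑ b w) ⟨
  c * Q + Q * c                                      ≡⟨ cong (c * Q +_) (*-comm Q c) ⟩
  c * Q + c * Q                                      ∎)
  where
  open ≤-Reasoning
  a b : Fin n → ℕ
  a y = w y * d y
  b y = w y * (d y * d y)
  e = sum a
  c = sum w
  Q = sum b
  ∑∑ : (Fin n → Fin n → ℕ) → ℕ
  ∑∑ f = ∑[ y < n ] ∑[ z < n ] f y z
  pointwise : ∀ y z → a y * a z + a y * a z ≤ w y * b z + b y * w z
  pointwise y z = subst₂ _≤_ (lhs (w y) (w z) (d y) (d z)) (rhs (w y) (w z) (d y) (d z))
                    (*-monoʳ-≤ (w y * w z) (am-gm (d y) (d z)))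
    where
    lhs : ∀ u v s t → (u * v) * (2 * (s * t)) ≡ (u * s) * (v * t) + (u * s) * (v * t)
    lhs = solve-∀
    rhs : ∀ u v s t → (u * v) * (s * s + t * t) ≡ u * (v * (t * t)) + (u * (s * s)) * v
    rhs = solve-∀

argmax : ∀ {n} → 1 ≤ n → (g : Fin n → ℕ) → ∃ λ x → ∀ y → g y ≤ g x
argmax {suc zero}    _ g = zero , λ { zero → ≤-refl }
argmax {suc (suc n)} _ g with argmax {suc n} (s≤s z≤n) (g ∘ suc)
... | x , max with g (suc x) ≤? g zero
...   | yes gx≤g0 = zero  , λ { zero → ≤-refl ; (suc y) → ≤-trans (max y) gx≤g0 }
...   | no  gx≰g0 = suc x , λ { zero → <⇒≤ (≰⇒> gx≰g0) ; (suc y) → max y }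

*-cancelʳ-≤-through : ∀ {n t c q} → 1 ≤ n → t * q ≤ n → n ≤ c * q → t ≤ c
*-cancelʳ-≤-through {c = c} {zero}  1≤n _ n≤c*0 =
  contradiction (≤-trans 1≤n (≤-trans n≤c*0 (≤-reflexive (*-zeroʳ c)))) λ ()
*-cancelʳ-≤-through {t = t} {c} {suc q} _ t*q≤n n≤c*q = *-cancelʳ-≤ t c (suc q) (≤-trans t*q≤n n≤c*q)

-- Embeddings

-- a ≼ b: a pair of kind b can carry an edge of F of kind a, in the sense of _⊆_.
data _≼_ : Kind → Kind → Set where
  none≼ : ∀ {k} → none ≼ k
  und≼  : ∀ {k} → k ≢ none → und ≼ k
  fwd≼  : fwd ≼ fwd
  bwd≼  : bwd ≼ bwd

_≼?_ : ∀ a b → Dec (a ≼ b)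
none ≼? b    = yes none≼
und  ≼? none = no λ { (und≼ b≢none) → b≢none refl }
und  ≼? und  = yes (und≼ λ ())
und  ≼? fwd  = yes (und≼ λ ())
und  ≼? bwd  = yes (und≼ λ ())
fwd  ≼? fwd  = yes fwd≼
fwd  ≼? none = no λ ()
fwd  ≼? und  = no λ ()
fwd  ≼? bwd  = no λ ()
bwd  ≼? bwd  = yes bwd≼
bwd  ≼? none = no λ ()
bwd  ≼? und  = no λ ()
bwd  ≼? fwd  = no λ ()

≼-trans : ∀ {a b c} → a ≼ b → b ≼ c → a ≼ c
≼-trans none≼           _              = none≼
≼-trans (und≼ b≢none)   none≼          = contradiction refl b≢none
≼-trans (und≼ _)        (und≼ c≢none)  = und≼ c≢none
≼-trans (und≼ _)        fwd≼           = und≼ λ ()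
≼-trans (und≼ _)        bwd≼           = und≼ λ ()
≼-trans fwd≼            fwd≼           = fwd≼
≼-trans bwd≼            bwd≼           = bwd≼

und≼⇒≢none : ∀ {b} → und ≼ b → b ≢ none
und≼⇒≢none (und≼ b≢none) = b≢none

fwd≼⇒≡fwd : ∀ {b} → fwd ≼ b → b ≡ fwd
fwd≼⇒≡fwd fwd≼ = refl

⊆⇒≼ : ∀ {k n} {F : MixedGraph k} {G : MixedGraph n} (F⊆G : F ⊆ G) →
      ∀ i j → kind F i j ≼ kind G (proj₁ F⊆G i) (proj₁ F⊆G j)
⊆⇒≼ {F = F} {G} (φ , _ , und⇒edge , fwd⇒fwd) i j with kind F i j in eq
... | none = none≼
... | und  = und≼ (und⇒edge i j eq)
... | fwd  = subst (fwd ≼_) (sym (fwd⇒fwd i j eq)) fwd≼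
... | bwd  = subst (bwd ≼_) (sym image-bwd) bwd≼
  where
  image-bwd : kind G (φ i) (φ j) ≡ bwd
  image-bwd = trans (symm G (φ j) (φ i)) (cong flip (fwd⇒fwd j i (trans (symm F i j) (cong flip eq))))

≼⇒⊆ : ∀ {k n} {F : MixedGraph k} {G : MixedGraph n} (φ : Fin k → Fin n) → Injective _≡_ _≡_ φ →
      (∀ i j → kind F i j ≼ kind G (φ i) (φ j)) → F ⊆ G
≼⇒⊆ {F = F} {G} φ φ-injective φ-≼ = φ , φ-injective , und⇒edge , fwd⇒fwd
  where
  und⇒edge : ∀ i j → kind F i j ≡ und → kind G (φ i) (φ j) ≢ none
  und⇒edge i j eq with φ-≼ i j
  ... | und-≼ rewrite eq = und≼⇒≢none und-≼
  fwd⇒fwd : ∀ i j → kind F i j ≡ fwd → kind G (φ i) (φ j) ≡ fwd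
  fwd⇒fwd i j eq with φ-≼ i j
  ... | fwd-≼ rewrite eq = fwd≼⇒≡fwd fwd-≼

⊆-trans : ∀ {a b c} {F : MixedGraph a} {H : MixedGraph b} {G : MixedGraph c} → F ⊆ H → H ⊆ G → F ⊆ G
⊆-trans {F = F} {H} {G} F⊆H@(φ , φ-injective , _) H⊆G@(ψ , ψ-injective , _) =
  ≼⇒⊆ {F = F} {G} (ψ ∘ φ) (φ-injective ∘ ψ-injective)
    (λ i j → ≼-trans (⊆⇒≼ {F = F} {H} F⊆H i j) (⊆⇒≼ {F = H} {G} H⊆G (φ i) (φ j)))

-- Directed complete bipartite graphs

inLeft-↑ˡ : ∀ {m} (a : Fin m) n → (toℕ (a ↑ˡ n) <ᵇ m) ≡ true
inLeft-↑ˡ {suc m} zero    n = refl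
inLeft-↑ˡ {suc m} (suc a) n = inLeft-↑ˡ a n

inLeft-↑ʳ : ∀ {m} n (b : Fin m) → (toℕ (n ↑ʳ b) <ᵇ n) ≡ false
inLeft-↑ʳ zero    b = refl
inLeft-↑ʳ (suc n) b = inLeft-↑ʳ n b

↑ˡ≢↑ʳ : ∀ {t} (a b : Fin t) → a ↑ˡ t ≢ t ↑ʳ b
↑ˡ≢↑ʳ {t} a b eq with trans (sym (inLeft-↑ˡ a t)) (trans (cong (λ i → toℕ i <ᵇ t) eq) (inLeft-↑ʳ t b))
... | ()

data Half (t : ℕ) : Fin (t + t) → Set where
  left  : (a : Fin t) → Half t (a ↑ˡ t)
  right : (b : Fin t) → Half t (t ↑ʳ b)

half : ∀ t i → Half t i
half t i with splitAt t i in eq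
... | inj₁ a = subst (Half t) (splitAt⁻¹-↑ˡ eq) (left a)
... | inj₂ b = subst (Half t) (splitAt⁻¹-↑ʳ eq) (right b)

K⃗-⊆ : ∀ {n t} (G : MixedGraph n) (A B : Fin t → Fin n) → Injective _≡_ _≡_ A → Injective _≡_ _≡_ B →
       (∀ a b → kind G (A a) (B b) ≡ fwd) → K⃗ t t ⊆ G
K⃗-⊆ {n} {t} G A B A-injective B-injective A⇒B = ≼⇒⊆ {F = K⃗ t t} {G} φ φ-injective φ-≼
  where
  φ : Fin (t + t) → Fin n
  φ i = [ A , B ]′ (splitAt t i)
  φ-left : ∀ a → φ (a ↑ˡ t) ≡ A a
  φ-left a = cong [ A , B ]′ (splitAt-↑ˡ t a t)
  φ-right : ∀ b → φ (t ↑ʳ b) ≡ B b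
  φ-right b = cong [ A , B ]′ (splitAt-↑ʳ t t b)
  A≢B : ∀ a b → A a ≢ B b
  A≢B a b eq with trans (sym (A⇒B a b)) (trans (cong (λ x → kind G x (B b)) eq) (loopless G (B b)))
  ... | ()
  φ-injective : Injective _≡_ _≡_ φ
  φ-injective {i} {j} eq with half t i | half t j
  ... | left a  | left a'  = cong (_↑ˡ t) (A-injective (trans (sym (φ-left a)) (trans eq (φ-left a'))))
  ... | left a  | right b' = contradiction (trans (sym (φ-left a)) (trans eq (φ-right b'))) (A≢B a b')
  ... | right b | left a'  = contradiction (trans (sym (φ-left a')) (trans (sym eq) (φ-right b))) (A≢B a' b)
  ... | right b | right b' = cong (t ↑ʳ_) (B-injective (trans (sym (φ-right b)) (trans eq (φ-right b'))))
  φ-≼ : ∀ i j → kind (K⃗ t t) i j ≼ kind G (φ i) (φ j)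
  φ-≼ i j with half t i | half t j
  ... | left a  | left a'  rewrite inLeft-↑ˡ a t | inLeft-↑ˡ a' t = none≼
  ... | left a  | right b  rewrite inLeft-↑ˡ a t | inLeft-↑ʳ t b | φ-left a | φ-right b | A⇒B a b = fwd≼
  ... | right b | left a   rewrite inLeft-↑ʳ t b | inLeft-↑ˡ a t | φ-left a | φ-right b
                                 | symm G (A a) (B b) | A⇒B a b = bwd≼
  ... | right b | right b' rewrite inLeft-↑ʳ t b | inLeft-↑ʳ t b' = none≼

IsBipartition : ∀ {k} → MixedGraph k → (Fin k → Bool) → Set
IsBipartition F c = ∀ i j → kind F i j ≼ kindK (c i) (c j)

bipartition? : ∀ {k} (F : MixedGraph k) → Dec (∃ (IsBipartition F))
bipartition? {k} F with anySubset? {n = k} (λ v → all? λ i → all? λ j → kind F i j ≼? kindK (lookup v i) (lookup v j))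
... | yes (v , bip) = yes (lookup v , bip)
... | no ∄bip = no λ (c , bip) → ∄bip (tabulate c , λ i j →
        subst₂ (λ x y → kind F i j ≼ kindK x y) (sym (lookup∘tabulate c i)) (sym (lookup∘tabulate c j)) (bip i j))

⊆K⃗⇒bipartition : ∀ {k t} (F : MixedGraph k) → F ⊆ K⃗ t t → ∃ (IsBipartition F)
⊆K⃗⇒bipartition {t = t} F F⊆K@(φ , _) = (λ i → toℕ (φ i) <ᵇ t) , ⊆⇒≼ {F = F} {K⃗ t t} F⊆K

bipartition⇒⊆K⃗ : ∀ {k} (F : MixedGraph k) (c : Fin k → Bool) → IsBipartition F c → F ⊆ K⃗ (suc k) (suc k)
bipartition⇒⊆K⃗ {k} F c bip = ≼⇒⊆ {F = F} {K⃗ t t} φ φ-injective φ-≼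
  where
  t = suc k
  φ : Fin k → Fin (t + t)
  φ i = if c i then suc i ↑ˡ t else t ↑ʳ suc i
  φ-side : ∀ i → (toℕ (φ i) <ᵇ t) ≡ c i
  φ-side i with c i
  ... | true  = inLeft-↑ˡ (suc i) t
  ... | false = inLeft-↑ʳ t (suc i)
  φ-injective : Injective _≡_ _≡_ φ
  φ-injective {i} {j} eq with c i | c j
  ... | true  | true  = Fin.suc-injective (↑ˡ-injective t (suc i) (suc j) eq)
  ... | true  | false = contradiction eq (↑ˡ≢↑ʳ (suc i) (suc j))
  ... | false | true  = contradiction (sym eq) (↑ˡ≢↑ʳ (suc j) (suc i))
  ... | false | false = Fin.suc-injective (↑ʳ-injective t (suc i) (suc j) eq)
  φ-≼ : ∀ i j → kind F i j ≼ kind (K⃗ t t) (φ i) (φ j)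
  φ-≼ i j = subst₂ (λ x y → kind F i j ≼ kindK x y) (sym (φ-side i)) (sym (φ-side j)) (bip i j)

isFwd : Kind → Bool
isFwd fwd = true
isFwd _   = false

arcs : ∀ {n} → MixedGraph n → ℕ
arcs {n} G = ∑[ i < n ] ∑[ j < n ] 𝟙 (isFwd (kind G i j))

countPairs≡∑ : ∀ {n} (G : MixedGraph n) p →
  countPairs G p ≡ ∑[ i < n ] ∑[ j < n ] 𝟙 ((toℕ i <ᵇ toℕ j) ∧ p (kind G i j))
countPairs≡∑ {n} G p = trans (cong sumList (map-cong (λ i → sumList-allFin {n} _) (allFin n))) (sumList-allFin {n} _)

<⇒<ᵇ≡true : ∀ {m n} → m < n → (m <ᵇ n) ≡ true
<⇒<ᵇ≡true (s≤s z≤n)       = refl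
<⇒<ᵇ≡true (s≤s (s≤s m<n)) = <⇒<ᵇ≡true (s≤s m<n)

≥⇒<ᵇ≡false : ∀ {m n} → n ≤ m → (m <ᵇ n) ≡ false
≥⇒<ᵇ≡false z≤n       = refl
≥⇒<ᵇ≡false (s≤s n≤m) = ≥⇒<ᵇ≡false n≤m

directed-split : ∀ k b → 𝟙 (b ∧ isDir k) + 𝟙 (not b ∧ isDir (flip k)) ≡ 𝟙 (isFwd k) + 𝟙 (isFwd (flip k))
directed-split none true  = refl
directed-split und  true  = refl
directed-split fwd  true  = refl
directed-split bwd  true  = refl
directed-split none false = refl
directed-split und  false = refl
directed-split fwd  false = refl
directed-split bwd  false = refl

directed-pair : ∀ {n} (G : MixedGraph n) i j →
  𝟙 ((toℕ i <ᵇ toℕ j) ∧ isDir (kind G i j)) + 𝟙 ((toℕ j <ᵇ toℕ i) ∧ isDir (kind G j i))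
    ≡ 𝟙 (isFwd (kind G i j)) + 𝟙 (isFwd (kind G j i))
directed-pair G i j rewrite symm G i j with <-cmp (toℕ i) (toℕ j)
... | tri< i<j _ _ rewrite <⇒<ᵇ≡true i<j | ≥⇒<ᵇ≡false (<⇒≤ i<j) = directed-split (kind G i j) true
... | tri> _ _ j<i rewrite <⇒<ᵇ≡true j<i | ≥⇒<ᵇ≡false (<⇒≤ j<i) = directed-split (kind G i j) false
... | tri≈ _ i≡j _ rewrite Fin.toℕ-injective i≡j | loopless G j | ≥⇒<ᵇ≡false (≤-refl {toℕ j}) = refl

countPairs-isDir≡arcs : ∀ {n} (G : MixedGraph n) → countPairs G isDir ≡ arcs G
countPairs-isDir≡arcs {n} G = double-cancel-≡ (begin
  D + D
    ≡⟨ cong₂ _+_ (countPairs≡∑ G isDir) (trans (countPairs≡∑ G isDir) (∑-comm {n} {n} _)) ⟩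
  ∑∑ (λ i j → d i j) + ∑∑ (λ i j → d j i)    ≡⟨ ∑∑-distrib-+ {n} {n} _ _ ⟨
  ∑∑ (λ i j → d i j + d j i)                 ≡⟨ sum-cong-≗ (λ i → sum-cong-≗ (directed-pair G i)) ⟩
  ∑∑ (λ i j → f i j + f j i)                 ≡⟨ ∑∑-distrib-+ {n} {n} _ _ ⟩
  ∑∑ (λ i j → f i j) + ∑∑ (λ i j → f j i)    ≡⟨ cong (arcs G +_) (∑-comm {n} {n} _) ⟨
  arcs G + arcs G                            ∎)
  where
  open ≡-Reasoning
  D = countPairs G isDir
  d f : Fin n → Fin n → ℕ
  d i j = 𝟙 ((toℕ i <ᵇ toℕ j) ∧ isDir (kind G i j))
  f i j = 𝟙 (isFwd (kind G i j))
  ∑∑ : (Fin n → Fin n → ℕ) → ℕ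
  ∑∑ g = ∑[ i < n ] ∑[ j < n ] g i j

∑-halves : ∀ t (g : Bool → ℕ) → ∑[ i < t + t ] g (toℕ i <ᵇ t) ≡ t * g true + t * g false
∑-halves t g = begin
  ∑[ i < t + t ] g (toℕ i <ᵇ t)
    ≡⟨ ∑-splitAt t t _ ⟩
  ∑[ a < t ] g (toℕ (a ↑ˡ t) <ᵇ t) + ∑[ b < t ] g (toℕ (t ↑ʳ b) <ᵇ t)
    ≡⟨ cong₂ _+_ (sum-cong-≗ {t} (λ a → cong g (inLeft-↑ˡ a t)))
                 (sum-cong-≗ {t} (λ b → cong g (inLeft-↑ʳ t b))) ⟩
  ∑[ a < t ] g true + ∑[ b < t ] g false
    ≡⟨ cong₂ _+_ (∑-const t _) (∑-const t _) ⟩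
  t * g true + t * g false ∎
  where open ≡-Reasoning

isFwd-kindK : ∀ x y → isFwd (kindK x y) ≡ x ∧ not y
isFwd-kindK true  true  = refl
isFwd-kindK true  false = refl
isFwd-kindK false true  = refl
isFwd-kindK false false = refl

arcs-K⃗ : ∀ t → arcs (K⃗ t t) ≡ t * t
arcs-K⃗ t = begin
  arcs (K⃗ t t)
    ≡⟨ sum-cong-≗ (λ i → sum-cong-≗ (λ j → 𝟙-fwd (side i) (side j))) ⟩
  ∑[ i < t + t ] ∑[ j < t + t ] (𝟙 (side i) * 𝟙 (not (side j)))
    ≡⟨ ∑*∑ (𝟙 ∘ side) (𝟙 ∘ not ∘ side) ⟨
  (∑[ i < t + t ] 𝟙 (side i)) * (∑[ j < t + t ] 𝟙 (not (side j)))
    ≡⟨ cong₂ _*_ (∑-halves t 𝟙) (∑-halves t (𝟙 ∘ not)) ⟩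
  (t * 1 + t * 0) * (t * 0 + t * 1)
    ≡⟨ simplify t ⟩
  t * t ∎
  where
  open ≡-Reasoning
  side : Fin (t + t) → Bool
  side i = toℕ i <ᵇ t
  𝟙-fwd : ∀ x y → 𝟙 (isFwd (kindK x y)) ≡ 𝟙 x * 𝟙 (not y)
  𝟙-fwd x y = trans (cong 𝟙 (isFwd-kindK x y)) (𝟙-∧ x (not y))
  simplify : ∀ t → (t * 1 + t * 0) * (t * 0 + t * 1) ≡ t * t
  simplify = solve-∀

-- The Kővári–Sós–Turán bound

m≤2m² : ∀ m → m ≤ 2 * (m * m)
m≤2m² zero        = z≤n
m≤2m² m@(suc _)   = ≤-trans (m≤m*n m m) (m≤m+n (m * m) _)

grow : ℕ → ℕ → ℕ
grow zero    m = m
grow (suc s) m = grow s (2 * (m * m))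

≤-grow : ∀ s m → m ≤ grow s m
≤-grow zero    m = ≤-refl
≤-grow (suc s) m = ≤-trans (m≤2m² m) (≤-grow s (2 * (m * m)))

absorb-removal : ∀ {n f f′ m} → n * n ≤ f * (m * m) → f ≤ f′ + n → 2 * (m * m) ≤ n →
                 n * n ≤ f′ * (2 * (m * m))
absorb-removal {n} {f} {f′} {m} big f≤f′+n 2m²≤n = +-cancelʳ-≤ (n * n) (n * n) _ (begin
  n * n + n * n                          ≤⟨ +-mono-≤ big big ⟩
  f * (m * m) + f * (m * m)              ≤⟨ +-mono-≤ (*-monoˡ-≤ (m * m) f≤f′+n) (*-monoˡ-≤ (m * m) f≤f′+n) ⟩
  (f′ + n) * (m * m) + (f′ + n) * (m * m) ≡⟨ expand f′ n m ⟩
  f′ * (2 * (m * m)) + n * (2 * (m * m)) ≤⟨ +-monoʳ-≤ (f′ * (2 * (m * m))) (*-monoʳ-≤ n 2m²≤n) ⟩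
  f′ * (2 * (m * m)) + n * n             ∎)
  where
  open ≤-Reasoning
  expand : ∀ f′ n m → (f′ + n) * (m * m) + (f′ + n) * (m * m) ≡ f′ * (2 * (m * m)) + n * (2 * (m * m))
  expand = solve-∀

module Greedy {n : ℕ} (E : Fin n → Fin n → Bool) where

  inDegree : (Fin n → Bool) → Fin n → ℕ
  inDegree X y = ∑[ x < n ] 𝟙 (X x ∧ E x y)

  arcsBetween : (Fin n → Bool) → (Fin n → Bool) → ℕ
  arcsBetween X Y = ∑[ y < n ] (𝟙 (Y y) * inDegree X y)

  _∩N⁺_ : (Fin n → Bool) → Fin n → Fin n → Bool
  (Y ∩N⁺ x) y = Y y ∧ E x y

  _─_ : (Fin n → Bool) → Fin n → Fin n → Bool
  (X ─ x) i = X i ∧ not (toℕ i ≡ᵇ toℕ x)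

  ─-≢ : ∀ X x {i} → (X ─ x) i ≡ true → i ≢ x
  ─-≢ X x {i} i∈X─x refl =
    subst T (not-injective (∧-conicalʳ (X i) _ i∈X─x)) (≡⇒≡ᵇ (toℕ i) (toℕ i) refl)

  inDegree≤n : ∀ X y → inDegree X y ≤ n
  inDegree≤n X y = ∣X∣≤n (λ x → X x ∧ E x y)

  arcsBetween≤ : ∀ X Y → arcsBetween X Y ≤ ∣ Y ∣ * n
  arcsBetween≤ X Y = begin
    arcsBetween X Y               ≤⟨ ∑-mono-≤ (λ y → *-monoʳ-≤ (𝟙 (Y y)) (inDegree≤n X y)) ⟩
    ∑[ y < n ] (𝟙 (Y y) * n)      ≡⟨ *-distribʳ-sum {n} n (𝟙 ∘ Y) ⟨
    ∣ Y ∣ * n                      ∎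
    where open ≤-Reasoning

  arcs-into-outNeighbourhoods : ∀ X Y →
    ∑[ x < n ] (𝟙 (X x) * arcsBetween X (Y ∩N⁺ x)) ≡ ∑[ y < n ] (𝟙 (Y y) * (inDegree X y * inDegree X y))
  arcs-into-outNeighbourhoods X Y = begin
    ∑[ x < n ] (𝟙 (X x) * arcsBetween X (Y ∩N⁺ x))
      ≡⟨ sum-cong-≗ {n} (λ x → *-distribˡ-sum {n} (𝟙 (X x)) _) ⟩
    ∑[ x < n ] ∑[ y < n ] (𝟙 (X x) * (𝟙 (Y y ∧ E x y) * d y))
      ≡⟨ sum-cong-≗ {n} (λ x → sum-cong-≗ {n} (λ y → regroup x y)) ⟩
    ∑[ x < n ] ∑[ y < n ] ((𝟙 (Y y) * d y) * 𝟙 (X x ∧ E x y))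
      ≡⟨ ∑-comm {n} {n} _ ⟩
    ∑[ y < n ] ∑[ x < n ] ((𝟙 (Y y) * d y) * 𝟙 (X x ∧ E x y))
      ≡⟨ sum-cong-≗ {n} (λ y → *-distribˡ-sum {n} (𝟙 (Y y) * d y) (λ x → 𝟙 (X x ∧ E x y))) ⟨
    ∑[ y < n ] ((𝟙 (Y y) * d y) * d y)
      ≡⟨ sum-cong-≗ {n} (λ y → *-assoc (𝟙 (Y y)) (d y) (d y)) ⟩
    ∑[ y < n ] (𝟙 (Y y) * (d y * d y)) ∎
    where
    open ≡-Reasoning
    d = inDegree X
    regroup : ∀ x y → 𝟙 (X x) * (𝟙 (Y y ∧ E x y) * d y) ≡ (𝟙 (Y y) * d y) * 𝟙 (X x ∧ E x y)
    regroup x y rewrite 𝟙-∧ (Y y) (E x y) | 𝟙-∧ (X x) (E x y) = commute (𝟙 (X x)) (𝟙 (Y y)) (𝟙 (E x y)) (d y)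
      where
      commute : ∀ a b e d → a * ((b * e) * d) ≡ (b * d) * (a * e)
      commute = solve-∀

  inDegree-─ : ∀ X x y → inDegree X y ≤ inDegree (X ─ x) y + 1
  inDegree-─ X x y = begin
    inDegree X y
      ≤⟨ ∑-mono-≤ (λ i → pointwise (X i) _ (E i y)) ⟩
    ∑[ i < n ] (𝟙 ((X ─ x) i ∧ E i y) + 𝟙 (toℕ i ≡ᵇ toℕ x))
      ≡⟨ ∑-distrib-+ {n} (λ i → 𝟙 ((X ─ x) i ∧ E i y)) _ ⟩
    inDegree (X ─ x) y + ∑[ i < n ] 𝟙 (toℕ i ≡ᵇ toℕ x)
      ≡⟨ cong (inDegree (X ─ x) y +_) (∑-indicator x) ⟩
    inDegree (X ─ x) y + 1 ∎
    where
    open ≤-Reasoning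
    pointwise : ∀ a b e → 𝟙 (a ∧ e) ≤ 𝟙 ((a ∧ not b) ∧ e) + 𝟙 b
    pointwise true  true  true  = ≤-refl
    pointwise true  true  false = z≤n
    pointwise true  false e     = m≤m+n _ _
    pointwise false b     e     = z≤n

  arcsBetween-─ : ∀ X x Z → arcsBetween X Z ≤ arcsBetween (X ─ x) Z + n
  arcsBetween-─ X x Z = begin
    arcsBetween X Z
      ≤⟨ ∑-mono-≤ (λ y → *-monoʳ-≤ (𝟙 (Z y)) (inDegree-─ X x y)) ⟩
    ∑[ y < n ] (𝟙 (Z y) * (inDegree (X ─ x) y + 1))
      ≡⟨ sum-cong-≗ {n} (λ y → distrib (𝟙 (Z y)) (inDegree (X ─ x) y)) ⟩
    ∑[ y < n ] (𝟙 (Z y) * inDegree (X ─ x) y + 𝟙 (Z y))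
      ≡⟨ ∑-distrib-+ {n} (λ y → 𝟙 (Z y) * inDegree (X ─ x) y) _ ⟩
    arcsBetween (X ─ x) Z + ∣ Z ∣
      ≤⟨ +-monoʳ-≤ _ (∣X∣≤n Z) ⟩
    arcsBetween (X ─ x) Z + n ∎
    where
    open ≤-Reasoning
    distrib : ∀ a d → a * (d + 1) ≡ a * d + a
    distrib = solve-∀

  rich-vertex : ∀ X Y m → 1 ≤ n → n * n ≤ arcsBetween X Y * m →
                ∃ λ x → X x ≡ true × n * n ≤ arcsBetween X (Y ∩N⁺ x) * (m * m)
  rich-vertex X Y m 1≤n big = x₀ , x₀∈X , subst (λ k → n * n ≤ k * (m * m)) g[x₀]≡f[x₀] g-bound
    where
    f g : Fin n → ℕ
    f x = arcsBetween X (Y ∩N⁺ x)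
    g x = 𝟙 (X x) * f x
    x₀ = proj₁ (argmax 1≤n g)
    e = arcsBetween X Y
    0<n*n : 0 < n * n
    0<n*n = *-mono-≤ 1≤n 1≤n
    e*e≤ : e * e ≤ n * (n * g x₀)
    e*e≤ = begin
      e * e
        ≤⟨ cauchy-schwarz (𝟙 ∘ Y) (inDegree X) ⟩
      ∣ Y ∣ * ∑[ y < n ] (𝟙 (Y y) * (inDegree X y * inDegree X y))
        ≡⟨ cong (∣ Y ∣ *_) (arcs-into-outNeighbourhoods X Y) ⟨
      ∣ Y ∣ * sum g
        ≤⟨ *-mono-≤ (∣X∣≤n Y) (∑-bounded (proj₂ (argmax 1≤n g))) ⟩
      n * (n * g x₀) ∎
      where open ≤-Reasoning
    g-bound : n * n ≤ (𝟙 (X x₀) * f x₀) * (m * m)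
    g-bound = *-cancelˡ-≤ (n * n) ⦃ >-nonZero 0<n*n ⦄ (begin
      (n * n) * (n * n)        ≤⟨ *-mono-≤ big big ⟩
      (e * m) * (e * m)        ≡⟨ square-product e m ⟩
      (e * e) * (m * m)        ≤⟨ *-monoˡ-≤ (m * m) e*e≤ ⟩
      (n * (n * g x₀)) * (m * m) ≡⟨ regroup n (g x₀) m ⟩
      (n * n) * (g x₀ * (m * m)) ∎)
      where
      open ≤-Reasoning
      square-product : ∀ e m → (e * m) * (e * m) ≡ (e * e) * (m * m)
      square-product = solve-∀
      regroup : ∀ n g m → (n * (n * g)) * (m * m) ≡ (n * n) * (g * (m * m))
      regroup = solve-∀
    x₀∈X : X x₀ ≡ true
    x₀∈X with X x₀ | g-bound
    ... | true  | _     = refl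
    ... | false | n*n≤0 = contradiction n*n≤0 (<⇒≱ 0<n*n)
    g[x₀]≡f[x₀] : g x₀ ≡ f x₀
    g[x₀]≡f[x₀] = trans (cong (λ b → 𝟙 b * f x₀) x₀∈X) (+-identityʳ (f x₀))

  greedy-step : ∀ X Y m → 1 ≤ n → 2 * (m * m) ≤ n → n * n ≤ arcsBetween X Y * m →
                ∃ λ x → X x ≡ true × n * n ≤ arcsBetween (X ─ x) (Y ∩N⁺ x) * (2 * (m * m))
  greedy-step X Y m 1≤n 2m²≤n big with rich-vertex X Y m 1≤n big
  ... | x , x∈X , rich = x , x∈X , absorb-removal {m = m} rich (arcsBetween-─ X x (Y ∩N⁺ x)) 2m²≤n

  record Fan (s : ℕ) (X Y : Fin n → Bool) (q : ℕ) : Set where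
    field
      centre           : Fin s → Fin n
      centre-injective : Injective _≡_ _≡_ centre
      centre∈X         : ∀ i → X (centre i) ≡ true
      leaves           : Fin n → Bool
      leaves⊆Y         : ∀ y → leaves y ≡ true → Y y ≡ true
      centre→leaf      : ∀ i y → leaves y ≡ true → E (centre i) y ≡ true
      leaves-large     : n ≤ ∣ leaves ∣ * q

  fan : ∀ s m X Y → 1 ≤ n → grow s m ≤ n → n * n ≤ arcsBetween X Y * m → Fan s X Y (grow s m)
  fan zero m X Y 1≤n _ big = record
    { centre = λ () ; centre-injective = λ {} ; centre∈X = λ () ; leaves = Y ; leaves⊆Y = λ _ y∈Y → y∈Y
    ; centre→leaf = λ () ; leaves-large = *-cancelˡ-≤ n ⦃ >-nonZero 1≤n ⦄ (begin
        n * n               ≤⟨ big ⟩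
        arcsBetween X Y * m ≤⟨ *-monoˡ-≤ m (arcsBetween≤ X Y) ⟩
        ∣ Y ∣ * n * m        ≡⟨ regroup ∣ Y ∣ n m ⟩
        n * (∣ Y ∣ * m)      ∎) }
    where
    open ≤-Reasoning
    regroup : ∀ c n m → c * n * m ≡ n * (c * m)
    regroup = solve-∀
  fan (suc s) m X Y 1≤n grow≤n big with greedy-step X Y m 1≤n (≤-trans (≤-grow s _) grow≤n) big
  ... | x , x∈X , big′ = record
    { centre = centre′ ; centre-injective = centre′-injective ; centre∈X = centre′∈X
    ; leaves = leaves ; leaves⊆Y = λ y ℓ → ∧-conicalˡ _ _ (leaves⊆Y y ℓ)
    ; centre→leaf = centre′→leaf ; leaves-large = leaves-large }
    where
    open Fan (fan s (2 * (m * m)) (X ─ x) (Y ∩N⁺ x) 1≤n grow≤n big′)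
    centre′ : Fin (suc s) → Fin n
    centre′ zero    = x
    centre′ (suc i) = centre i
    centre≢x : ∀ i → centre i ≢ x
    centre≢x i = ─-≢ X x (centre∈X i)
    centre′-injective : Injective _≡_ _≡_ centre′
    centre′-injective {zero}  {zero}  _  = refl
    centre′-injective {zero}  {suc j} eq = contradiction (sym eq) (centre≢x j)
    centre′-injective {suc i} {zero}  eq = contradiction eq (centre≢x i)
    centre′-injective {suc i} {suc j} eq = cong suc (centre-injective eq)
    centre′∈X : ∀ i → X (centre′ i) ≡ true
    centre′∈X zero    = x∈X
    centre′∈X (suc i) = ∧-conicalˡ _ _ (centre∈X i)
    centre′→leaf : ∀ i y → leaves y ≡ true → E (centre′ i) y ≡ true
    centre′→leaf zero    y ℓ = ∧-conicalʳ _ _ (leaves⊆Y y ℓ)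
    centre′→leaf (suc i) y ℓ = centre→leaf i y ℓ

choose : ∀ {n} (P : Fin n → Bool) {t} → t ≤ ∣ P ∣ →
         Σ (Fin t → Fin n) λ B → Injective _≡_ _≡_ B × ∀ i → P (B i) ≡ true
choose {zero} P z≤n = (λ ()) , (λ {}) , (λ ())
choose {suc n} P {t} t≤ with P zero in P0
... | false with choose (P ∘ suc) t≤
...   | B , B-injective , B⊆P = suc ∘ B , B-injective ∘ Fin.suc-injective , B⊆P
choose {suc n} P {zero}  _         | true = (λ ()) , (λ {}) , (λ ())
choose {suc n} P {suc t} (s≤s t≤)  | true with choose (P ∘ suc) t≤
... | B , B-injective , B⊆P = B′ , B′-injective , B′⊆P
  where
  B′ : Fin (suc t) → Fin (suc n)
  B′ zero    = zero
  B′ (suc i) = suc (B i)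
  B′-injective : Injective _≡_ _≡_ B′
  B′-injective {zero}  {zero}  _  = refl
  B′-injective {suc i} {suc j} eq = cong suc (B-injective (Fin.suc-injective eq))
  B′⊆P : ∀ i → P (B′ i) ≡ true
  B′⊆P zero    = P0
  B′⊆P (suc i) = B⊆P i

isFwd⇒≡fwd : ∀ {k} → isFwd k ≡ true → k ≡ fwd
isFwd⇒≡fwd {fwd} _ = refl

arcs≡arcsBetween : ∀ {n} (G : MixedGraph n) →
  arcs G ≡ Greedy.arcsBetween (λ x y → isFwd (kind G x y)) (λ _ → true) (λ _ → true)
arcs≡arcsBetween {n} G = trans (∑-comm {n} {n} _) (sum-cong-≗ {n} (λ y → sym (+-identityʳ _)))

kővári-sós-turán : ∀ {n} (G : MixedGraph n) t m → 1 ≤ n → suc t * grow t m ≤ n →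
                   n * n ≤ arcs G * m → K⃗ t t ⊆ G
kővári-sós-turán {n} G t m 1≤n bound big =
  K⃗-⊆ G centre B centre-injective B-injective (λ a b → isFwd⇒≡fwd (centre→leaf a (B b) (B⊆leaves b)))
  where
  open Greedy (λ x y → isFwd (kind G x y))
  q = grow t m
  open Fan (fan t m (λ _ → true) (λ _ → true) 1≤n (≤-trans (m≤m+n q (t * q)) bound)
                (subst (λ a → n * n ≤ a * m) (arcs≡arcsBetween G) big))
  t≤∣leaves∣ : t ≤ ∣ leaves ∣
  t≤∣leaves∣ = *-cancelʳ-≤-through 1≤n (≤-trans (m≤n+m (t * q) q) bound) leaves-large
  B = proj₁ (choose leaves t≤∣leaves∣)
  B-injective = proj₁ (proj₂ (choose leaves t≤∣leaves∣))
  B⊆leaves = proj₂ (proj₂ (choose leaves t≤∣leaves∣))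

-- Densities

2*pairs[n]+n≡n*n : ∀ n → 2 * pairs n + n ≡ n * n
2*pairs[n]+n≡n*n zero    = refl
2*pairs[n]+n≡n*n (suc n) = begin
  2 * (n + pairs n) + suc n     ≡⟨ shuffle n (pairs n) ⟩
  suc (n + n + (2 * pairs n + n)) ≡⟨ cong (λ x → suc (n + n + x)) (2*pairs[n]+n≡n*n n) ⟩
  suc (n + n + n * n)           ≡⟨ square n ⟩
  suc n * suc n                 ∎
  where
  open ≡-Reasoning
  shuffle : ∀ n p → 2 * (n + p) + suc n ≡ suc (n + n + (2 * p + n))
  shuffle = solve-∀
  square : ∀ n → suc (n + n + n * n) ≡ suc n * suc n
  square = solve-∀

n*n≤4*pairs[n] : ∀ {n} → 2 ≤ n → n * n ≤ 4 * pairs n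
n*n≤4*pairs[n] {n@(suc (suc k))} (s≤s (s≤s z≤n)) = begin
  n * n                     ≡⟨ 2*pairs[n]+n≡n*n n ⟨
  2 * pairs n + n           ≤⟨ +-monoʳ-≤ (2 * pairs n) n≤2*pairs ⟩
  2 * pairs n + 2 * pairs n ≡⟨ double (pairs n) ⟩
  4 * pairs n               ∎
  where
  open ≤-Reasoning
  double : ∀ p → 2 * p + 2 * p ≡ 4 * p
  double = solve-∀
  twice : ∀ k → 2 * suc k ≡ suc (suc (k + k))
  twice = solve-∀
  n≤2*pairs : n ≤ 2 * pairs n
  n≤2*pairs = begin
    suc (suc k)      ≤⟨ s≤s (s≤s (m≤m+n k k)) ⟩
    suc (suc (k + k)) ≡⟨ twice k ⟨
    2 * suc k        ≤⟨ *-monoʳ-≤ 2 (m≤m+n (suc k) _) ⟩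
    2 * pairs n      ∎

pairs[t+t]<2*t*t : ∀ {t} → 1 ≤ t → pairs (t + t) < 2 * (t * t)
pairs[t+t]<2*t*t {t} 1≤t = *-cancelˡ-< 2 _ _ (begin-strict
  2 * pairs (t + t)            <⟨ m<m+n _ (≤-trans 1≤t (m≤m+n t t)) ⟩
  2 * pairs (t + t) + (t + t)  ≡⟨ 2*pairs[n]+n≡n*n (t + t) ⟩
  (t + t) * (t + t)            ≡⟨ square t ⟩
  2 * (2 * (t * t))            ∎)
  where
  open ≤-Reasoning
  square : ∀ t → (t + t) * (t + t) ≡ 2 * (2 * (t * t))
  square = solve-∀

positive⇒fraction : ∀ ε → 0ℚ ℚ.< ε → ∃₂ λ a b → ε ≡ ℤ.+ suc a / suc b
positive⇒fraction ε@(mkℚ (ℤ.+ suc a) b _) _ = a , b , sym (ℚ.↥p/↧p≡p ε)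
positive⇒fraction (mkℚ (ℤ.+ zero) b _) (ℚ.*<* (ℤ.+<+ ()))
positive⇒fraction (mkℚ -[1+ a ] b _) (ℚ.*<* ())

toℚᵘ-fraction : ∀ a b → toℚᵘ (ℤ.+ a / suc b) ℚᵘ.≃ mkℚᵘ (ℤ.+ a) b
toℚᵘ-fraction a b = ℚ.toℚᵘ-fromℚᵘ (mkℚᵘ (ℤ.+ a) b)

fraction-<⇒ : ∀ a b c d → ℤ.+ a / suc b ℚ.< ℤ.+ c / suc d → a * suc d < c * suc b
fraction-<⇒ a b c d lt
  with ℚᵘ.<-respˡ-≃ (toℚᵘ-fraction a b) (ℚᵘ.<-respʳ-≃ (toℚᵘ-fraction c d) (ℚ.toℚᵘ-mono-< lt))
... | ℚᵘ.*<* lt′ = ℤ.drop‿+<+ (subst₂ ℤ._<_ (sym (ℤ.pos-* a (suc d))) (sym (ℤ.pos-* c (suc b))) lt′)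

fraction-<⇐ : ∀ a b c d → a * suc d < c * suc b → ℤ.+ a / suc b ℚ.< ℤ.+ c / suc d
fraction-<⇐ a b c d lt = ℚ.toℚᵘ-cancel-<
  (ℚᵘ.<-respˡ-≃ (ℚᵘ.≃-sym (toℚᵘ-fraction a b)) (ℚᵘ.<-respʳ-≃ (ℚᵘ.≃-sym (toℚᵘ-fraction c d))
    (ℚᵘ.*<* (subst₂ ℤ._<_ (ℤ.pos-* a (suc d)) (ℤ.pos-* c (suc b)) (ℤ.+<+ lt)))))

0≤density : ∀ n m → 0ℚ ℚ.≤ density n m
0≤density zero          m = ℚ.≤-refl
0≤density (suc zero)    m = ℚ.≤-refl
0≤density (suc (suc k)) m = ℚ.nonNegative⁻¹ _ ⦃ ℚ.normalize-nonNeg m (suc (k + pairs (suc k))) ⦄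

½<density : ∀ {n} m → 2 ≤ n → pairs n < 2 * m → ½ ℚ.< density n m
½<density {suc (suc k)} m (s≤s (s≤s z≤n)) p<2m =
  fraction-<⇐ 1 1 m (k + pairs (suc k)) (subst₂ _<_ (sym (*-identityˡ _)) (*-comm 2 m) p<2m)

fraction<density⇒ : ∀ {n} a b m → 2 ≤ n → ℤ.+ a / suc b ℚ.< density n m → a * pairs n < m * suc b
fraction<density⇒ {suc (suc k)} a b m (s≤s (s≤s z≤n)) = fraction-<⇒ a b m (k + pairs (suc k))

½<β[K⃗] : ∀ {t} → 1 ≤ t → ½ ℚ.< β (K⃗ t t)
½<β[K⃗] {t} 1≤t = ½<density _ (+-mono-≤ 1≤t 1≤t)
  (subst (λ D → pairs (t + t) < 2 * D) (sym (trans (countPairs-isDir≡arcs (K⃗ t t)) (arcs-K⃗ t)))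
    (pairs[t+t]<2*t*t 1≤t))

⊆K⃗⇒θ∞ : ∀ {k t} (F : MixedGraph k) → F ⊆ K⃗ t t → ThetaInfinite F
⊆K⃗⇒θ∞ {t = t} F F⊆K ε 0<ε with positive⇒fraction ε 0<ε
... | a , b , refl = 2 ⊔ suc t * grow t m , β≤ε
  where
  -- (a+1)/(b+1) < β G gives pairs n < (b+1) · arcs G, and n² ≤ 4 · pairs n.
  m = 4 * suc b
  β≤ε : ∀ n → 2 ⊔ suc t * grow t m ≤ n → (G : MixedGraph n) → Free F G → β G ℚ.≤ ℤ.+ suc a / suc b
  β≤ε n N≤n G F-free with β G ℚ.≤? ℤ.+ suc a / suc b
  ... | yes β≤ε = β≤ε
  ... | no  β≰ε = ⊥-elim (F-free (⊆-trans {F = F} {K⃗ t t} {G} F⊆K K⃗⊆G))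
    where
    2≤n = m⊔n≤o⇒m≤o 2 (suc t * grow t m) N≤n
    p = pairs n
    p<D*[b+1] : p < arcs G * suc b
    p<D*[b+1] = ≤-trans (s≤s (m≤m+n p (a * p)))
                  (subst (λ D → suc a * p < D * suc b) (countPairs-isDir≡arcs G)
                    (fraction<density⇒ (suc a) b _ 2≤n (ℚ.≰⇒> β≰ε)))
    many-arcs : n * n ≤ arcs G * m
    many-arcs = begin
      n * n                   ≤⟨ n*n≤4*pairs[n] 2≤n ⟩
      4 * p                   ≤⟨ *-monoʳ-≤ 4 (<⇒≤ p<D*[b+1]) ⟩
      4 * (arcs G * suc b)    ≡⟨ regroup 4 (arcs G) (suc b) ⟩
      arcs G * m              ∎
      where
      open ≤-Reasoning
      regroup : ∀ x y z → x * (y * z) ≡ y * (x * z)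
      regroup = solve-∀
    K⃗⊆G : K⃗ t t ⊆ G
    K⃗⊆G = kővári-sós-turán G t m (≤-trans (s≤s z≤n) 2≤n) (m⊔n≤o⇒n≤o 2 _ N≤n) many-arcs

N≤[1+N]+[1+N] : ∀ N → N ≤ suc N + suc N
N≤[1+N]+[1+N] N = ≤-trans (n≤1+n N) (m≤m+n (suc N) (suc N))

θ∞⇒bipartition : ∀ {k} (F : MixedGraph k) → ThetaInfinite F → ∃ (IsBipartition F)
θ∞⇒bipartition F θ∞ with bipartition? F
... | yes bip = bip
... | no ∄bip with θ∞ ½ (ℚ.positive⁻¹ ½)
...   | N , β≤½ = ⊥-elim (ℚ.<-irrefl refl (ℚ.<-≤-trans (½<β[K⃗] {M} (s≤s z≤n)) β[K⃗]≤½))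
  where
  M = suc N
  β[K⃗]≤½ : β (K⃗ M M) ℚ.≤ ½
  β[K⃗]≤½ = β≤½ (M + M) (N≤[1+N]+[1+N] N) (K⃗ M M) (∄bip ∘ ⊆K⃗⇒bipartition {t = M} F)

θ≤2 : ∀ {k} (F : MixedGraph k) → ¬ (∃ λ t → t ≥ 1 × F ⊆ K⃗ t t) → ThetaLe2 F
-- With ε = ρ/2 − 1, the bound α + ρβ ≤ 1 + ε = ρ/2 fails on K⃗ M M, where ρβ > ρ/2.
θ≤2 F ∄t ρ 2<ρ limsup≤1 =
  ℚ.<-irrefl refl (ℚ.<-≤-trans δ<value (ℚ.≤-trans value≤1+ε (ℚ.≤-reflexive 1+[δ-1]≡δ)))
  where
  instance ρ-positive : ℚ.Positive ρ
  ρ-positive = ℚ.positive (ℚ.<-trans (ℚ.positive⁻¹ (ℤ.+ 2 / 1)) 2<ρ)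
  δ = ρ ℚ.* ½
  0<δ-1 : 0ℚ ℚ.< δ ℚ.- 1ℚ
  0<δ-1 = ℚ.+-monoˡ-< (ℚ.- 1ℚ) (ℚ.*-monoˡ-<-pos ½ 2<ρ)
  1+[δ-1]≡δ : 1ℚ ℚ.+ (δ ℚ.- 1ℚ) ≡ δ
  1+[δ-1]≡δ = trans (sym (ℚ.+-assoc 1ℚ δ (ℚ.- 1ℚ))) (xyx⁻¹≈y 1ℚ δ)
  N = proj₁ (limsup≤1 (δ ℚ.- 1ℚ) 0<δ-1)
  M = suc N
  G = K⃗ M M
  value≤1+ε : α G ℚ.+ ρ ℚ.* β G ℚ.≤ 1ℚ ℚ.+ (δ ℚ.- 1ℚ)
  value≤1+ε = proj₂ (limsup≤1 (δ ℚ.- 1ℚ) 0<δ-1) (M + M) (N≤[1+N]+[1+N] N) G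
                λ F⊆G → ∄t (M , s≤s z≤n , F⊆G)
  ρβ≤value : ρ ℚ.* β G ℚ.≤ α G ℚ.+ ρ ℚ.* β G
  ρβ≤value = subst (ℚ._≤ α G ℚ.+ ρ ℚ.* β G) (ℚ.+-identityˡ _)
               (ℚ.+-monoˡ-≤ (ρ ℚ.* β G) (0≤density (M + M) (countPairs G isUnd)))
  δ<value : δ ℚ.< α G ℚ.+ ρ ℚ.* β G
  δ<value = ℚ.<-≤-trans (ℚ.*-monoʳ-<-pos ρ (½<β[K⃗] {M} (s≤s z≤n))) ρβ≤value

proposition2p7 : ∀ {k} (F : MixedGraph k) →
    (ThetaInfinite F ⇔ (∃ λ (t : ℕ) → t ≥ 1 × F ⊆ K⃗ t t)) ×
    (¬ (∃ λ (t : ℕ) → t ≥ 1 × F ⊆ K⃗ t t) → ThetaLe2 F)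
proposition2p7 {k} F = mk⇔ θ∞⇒⊆K⃗ (λ (t , _ , F⊆K) → ⊆K⃗⇒θ∞ {t = t} F F⊆K) , θ≤2 F
  where
  θ∞⇒⊆K⃗ : ThetaInfinite F → ∃ λ t → t ≥ 1 × F ⊆ K⃗ t t
  θ∞⇒⊆K⃗ θ∞ = let c , bip = θ∞⇒bipartition F θ∞ in suc k , s≤s z≤n , bipartition⇒⊆K⃗ F c bip
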